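{- There is no $\mathcal{L}^1_\#$ sentence $\varphi$ in unary predicates $P,Q$ such that for every finite model $\mathcal{M}$ with domain $D$ and $Q^\mathcal{M}\neq\emptyset$, $\mathcal{M}\models\varphi$ iff $\frac{|P^\mathcal{M}\cap Q^\mathcal{M}|}{|Q^\mathcal{M}|}>\frac{|P^\mathcal{M}|}{|D|}$. That is, ``Many $Q$s are $P$'' cannot be expressed in $\mathsf{MFO}^\phi(\#)$.
   Context: $\mathcal{L}^1_\#$ is monadic first-order logic with equality over finitely many unary predicates, extended with count comparisons $\#_x\varphi\succsim\#_y\psi$ (closed under Booleans, first-order quantifiers and nesting), where $\#_x\varphi\succsim\#_y\psi$ is true at an assignment iff $|\{d:\varphi\text{ holds with }x\mapsto d\}|\ge|\{d:\psi\text{ holds with }y\mapsto d\}|$. $\mathsf{MFO}^\phi(\#)$ is this logic over finite (nonempty) models. ``Many $Q$s are $P$'' is read as: the proportion of $P$s among the $Q$s exceeds the proportion of $P$s in the whole domain. -}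

module Defs where

open import Data.Nat using (ℕ; zero; suc; _+_; _*_; _≤ᵇ_; _≡ᵇ_; _>_)
open import Data.Bool using (Bool; true; false; not; _∧_; _∨_; if_then_else_)
open import Data.Fin using (Fin)
open import Data.List using (List; []; _∷_; map; allFin)
open import Data.Nat.ListAction using (sum)
open import Data.Bool.ListAction using (any)

data Sym : Set where
  P Q : Sym

Var : Set
Var = ℕ

data Formula : Set where
  atom  : Sym → Var → Formula
  _≐_   : Var → Var → Formula
  ⊤f    : Formula
  ¬f_   : Formula → Formula
  _∧f_  : Formula → Formula → Formula
  _∨f_  : Formula → Formula → Formula
  ∃f    : Var → Formula → Formula
  ∀f    : Var → Formula → Formula
  cnt   : Var → Formula → Var → Formula → Formula  -- #_x φ ≿ #_y ψ

-- x is bound in φ for the first argument, y in ψ for the third.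

_∈ᵇ_ : Var → List Var → Bool
x ∈ᵇ xs = any (λ y → x ≡ᵇ y) xs

closedUnder : List Var → Formula → Bool
closedUnder bs (atom s x)     = x ∈ᵇ bs
closedUnder bs (x ≐ y)        = (x ∈ᵇ bs) ∧ (y ∈ᵇ bs)
closedUnder bs ⊤f             = true
closedUnder bs (¬f φ)         = closedUnder bs φ
closedUnder bs (φ ∧f ψ)       = closedUnder bs φ ∧ closedUnder bs ψ
closedUnder bs (φ ∨f ψ)       = closedUnder bs φ ∧ closedUnder bs ψ
closedUnder bs (∃f x φ)       = closedUnder (x ∷ bs) φ
closedUnder bs (∀f x φ)       = closedUnder (x ∷ bs) φ
closedUnder bs (cnt x φ y ψ)  = closedUnder (x ∷ bs) φ ∧ closedUnder (y ∷ bs) ψ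

Sentence : Formula → Set
Sentence φ = closedUnder [] φ ≡ true
  where open import Relation.Binary.PropositionalEquality using (_≡_)

Interp : ℕ → Set
Interp n = Sym → Fin n → Bool

count : (n : ℕ) → (Fin n → Bool) → ℕ
count n f = sum (map (λ d → if f d then 1 else 0) (allFin n))

_[_↦_] : {n : ℕ} → (Var → Fin n) → Var → Fin n → (Var → Fin n)
(ρ [ x ↦ d ]) y = if y ≡ᵇ x then d else ρ y

finEq : {n : ℕ} → Fin n → Fin n → Bool
finEq a b = Data.Nat._≡ᵇ_ (Data.Fin.toℕ a) (Data.Fin.toℕ b)
  where import Data.Fin

anyFin : (n : ℕ) → (Fin n → Bool) → Bool
anyFin n f = any f (allFin n)

allFinB : (n : ℕ) → (Fin n → Bool) → Bool
allFinB n f = not (any (λ d → not (f d)) (allFin n))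

eval : {n : ℕ} → Interp n → Formula → (Var → Fin n) → Bool
eval {n} I (atom s x)    ρ = I s (ρ x)
eval {n} I (x ≐ y)       ρ = finEq (ρ x) (ρ y)
eval {n} I ⊤f            ρ = true
eval {n} I (¬f φ)        ρ = not (eval I φ ρ)
eval {n} I (φ ∧f ψ)      ρ = eval I φ ρ ∧ eval I ψ ρ
eval {n} I (φ ∨f ψ)      ρ = eval I φ ρ ∨ eval I ψ ρ
eval {n} I (∃f x φ)      ρ = anyFin n (λ d → eval I φ (ρ [ x ↦ d ]))
eval {n} I (∀f x φ)      ρ = allFinB n (λ d → eval I φ (ρ [ x ↦ d ]))
eval {n} I (cnt x φ y ψ) ρ =
  count n (λ d → eval I ψ (ρ [ y ↦ d ])) ≤ᵇ count n (λ d → eval I φ (ρ [ x ↦ d ]))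

-- Truth of a sentence in a (nonempty) finite model with domain Fin (suc n);
-- the assignment is irrelevant for sentences, we use the constant one.
_⊨_ : {n : ℕ} → Interp (suc n) → Formula → Set
_⊨_ {n} I φ = eval I φ (λ _ → Fin.zero) ≡ true
  where open import Relation.Binary.PropositionalEquality using (_≡_)
        import Data.Fin as Fin

#PQ #P #Q : {n : ℕ} → Interp n → ℕ
#PQ {n} I = count n (λ d → I P d ∧ I Q d)
#P  {n} I = count n (I P)
#Q  {n} I = count n (I Q)

-- "Many Qs are P": |P∩Q|/|Q| > |P|/|D|, with |D| = suc n,
-- stated cross-multiplied (valid since |Q|, |D| > 0).
ManyQP : {n : ℕ} → Interp (suc n) → Set
ManyQP {n} I = #PQ I * suc n > #P I * #Q I

{-# OPTIONS --safe #-}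
module Submission where

-- Take the models with cells PQ, P¬Q, ¬PQ, ¬P¬Q of sizes 1, t, t, D for D = t² + 1 and
-- D = t²: "many Qs are P" amounts to t² < D, so it holds in the first and fails in the
-- second.  If t is large compared with the quantifier rank of φ, φ cannot tell them apart.
-- Match the values of the variables in play by a partial isomorphism.  A subformula with one
-- new free variable takes a single value on all fresh elements of a cell, since any two of
-- them extend the partial isomorphism alike; the three small cells have equal sizes in both
-- models, so the set it defines has r + (0 or N) elements, with r the same in both models and
-- smaller than the number N of fresh ¬P¬Q-elements of either.  Whether such a count is
-- positive, and how two such counts compare, does not depend on N.

open import Defs
open import Data.Bool using (Bool; true; false; not; _∧_; _∨_; if_then_else_)
open import Data.Bool.ListAction using (any)
open import Data.Bool.Properties using (∧-identityʳ; ∧-zeroʳ; ∧-conicalˡ; ∧-conicalʳ; not-injective)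
open import Data.Empty using (⊥; ⊥-elim)
open import Data.Fin using (Fin; zero; suc; toℕ)
open import Data.List using (map; tabulate)
open import Data.Nat using (ℕ; zero; suc; _+_; _*_; _⊔_; _≤_; _<_; _≤ᵇ_; _≡ᵇ_; z≤n; s≤s; _≤?_; _≟_)
open import Data.Nat.ListAction using (sum)
open import Data.Nat.Properties
open import Algebra.Properties.CommutativeSemigroup +-commutativeSemigroup using (x∙yz≈y∙xz)
open import Data.Nat.Tactic.RingSolver using (solve-∀)
open import Data.Product using (Σ; ∃-syntax; _×_; _,_; proj₁; proj₂)
open import Data.Unit using (⊤; tt)
open import Data.Vec.Functional using (Vector; _∷_; replicate)
open import Function using (_∘_; const; _⇔_; mk⇔; Equivalence)
import Function.Properties.Equivalence as ⇔
open import Relation.Binary.PropositionalEquality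
open import Relation.Nullary using (¬_)
open import Relation.Nullary.Decidable using (dec-true; does-⇔)

when : Bool → ℕ → ℕ
when v N = if v then N else 0

when-≤ : ∀ v N → when v N ≤ N
when-≤ true  N = ≤-refl
when-≤ false N = z≤n

_is_ : Bool → Bool → Bool
a is true  = a
a is false = not a

is⇒≡ : ∀ a p → (a is p) ≡ true → a ≡ p
is⇒≡ a true  a≡true = a≡true
is⇒≡ a false ¬a     = not-injective ¬a

≤ᵇ-cong : ∀ {a₁ b₁ a₂ b₂} → (a₁ ≤ b₁ ⇔ a₂ ≤ b₂) → (a₁ ≤ᵇ b₁) ≡ (a₂ ≤ᵇ b₂)
≤ᵇ-cong {a₁} {b₁} {a₂} {b₂} eq = does-⇔ eq (a₁ ≤? b₁) (a₂ ≤? b₂)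

finEq-refl : ∀ {n} (a : Fin n) → finEq a a ≡ true
finEq-refl a = dec-true (toℕ a ≟ toℕ a) refl

finEq-sym : ∀ {n} (a b : Fin n) → finEq a b ≡ finEq b a
finEq-sym a b = does-⇔ (mk⇔ sym sym) (toℕ a ≟ toℕ b) (toℕ b ≟ toℕ a)

card : (n : ℕ) → (Fin n → Bool) → ℕ
card zero    f = 0
card (suc n) f = when (f zero) 1 + card n (f ∘ suc)

_∩_ : ∀ {n} → (Fin n → Bool) → (Fin n → Bool) → Fin n → Bool
(f ∩ g) d = f d ∧ g d

∁ : ∀ {n} → (Fin n → Bool) → Fin n → Bool
∁ f d = not (f d)

infixr 7 _∩_

count≡card : ∀ n (f : Fin n → Bool) → count n f ≡ card n f
count≡card n f = go n (λ d → d)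
  where
  go : ∀ k (h : Fin k → Fin n) →
       sum (map (λ d → if f d then 1 else 0) (tabulate h)) ≡ card k (f ∘ h)
  go zero    h = refl
  go (suc k) h = cong (when (f (h zero)) 1 +_) (go k (h ∘ suc))

anyFin≡count≰0 : ∀ n (f : Fin n → Bool) → anyFin n f ≡ not (count n f ≤ᵇ 0)
anyFin≡count≰0 n f = go n (λ d → d)
  where
  go : ∀ k (h : Fin k → Fin n) →
       any f (tabulate h) ≡ not (sum (map (λ d → if f d then 1 else 0) (tabulate h)) ≤ᵇ 0)
  go zero    h = refl
  go (suc k) h with f (h zero)
  ... | true  = refl
  ... | false = go k (h ∘ suc)

card-cong : ∀ n {f g : Fin n → Bool} → (∀ d → f d ≡ g d) → card n f ≡ card n g
card-cong zero    f≗g = refl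
card-cong (suc n) f≗g = cong₂ _+_ (cong (λ b → when b 1) (f≗g zero)) (card-cong n (f≗g ∘ suc))

card-const : ∀ n v → card n (const v) ≡ when v n
card-const zero    true  = refl
card-const (suc n) true  = cong suc (card-const n true)
card-const zero    false = refl
card-const (suc n) false = card-const n false

card-∩-const : ∀ n (f : Fin n → Bool) v → card n (f ∩ const v) ≡ when v (card n f)
card-∩-const n f true  = card-cong n (λ d → ∧-identityʳ (f d))
card-∩-const n f false = trans (card-cong n (λ d → ∧-zeroʳ (f d))) (card-const n false)

card-∩-constant : ∀ n (g f : Fin n → Bool) v → (∀ d → g d ≡ true → f d ≡ v) →
  card n (g ∩ f) ≡ when v (card n g)
card-∩-constant n g f v f≡v = trans (card-cong n pointwise) (card-∩-const n g v)
  where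
  pointwise : ∀ d → g d ∧ f d ≡ g d ∧ v
  pointwise d with g d in gd
  ... | true  = f≡v d gd
  ... | false = refl

card-split : ∀ n (g f : Fin n → Bool) → card n f ≡ card n (g ∩ f) + card n (∁ g ∩ f)
card-split zero    g f = refl
card-split (suc n) g f with g zero | card-split n (g ∘ suc) (f ∘ suc)
... | true  | ih = trans (cong (when (f zero) 1 +_) ih) (sym (+-assoc (when (f zero) 1) _ _))
... | false | ih = trans (cong (when (f zero) 1 +_) ih)
                          (x∙yz≈y∙xz (when (f zero) 1) (card n ((g ∘ suc) ∩ (f ∘ suc))) _)

card-∩-≤ : ∀ n (f g : Fin n → Bool) → card n (f ∩ g) ≤ card n f
card-∩-≤ zero    f g = z≤n
card-∩-≤ (suc n) f g with f zero | g zero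
... | true  | true  = s≤s (card-∩-≤ n (f ∘ suc) (g ∘ suc))
... | true  | false = m≤n⇒m≤1+n (card-∩-≤ n (f ∘ suc) (g ∘ suc))
... | false | _     = card-∩-≤ n (f ∘ suc) (g ∘ suc)

card-∩-empty : ∀ n (g f : Fin n → Bool) → card n g ≡ 0 → card n (g ∩ f) ≡ 0
card-∩-empty n g f g≡0 = n≤0⇒n≡0 (subst (card n (g ∩ f) ≤_) g≡0 (card-∩-≤ n g f))

card-witness : ∀ n (f : Fin n → Bool) → 0 < card n f → ∃[ d ] f d ≡ true
card-witness (suc n) f pos with f zero in f0
... | true  = zero , f0
... | false with card-witness n (f ∘ suc) pos
...   | d , fd = suc d , fd

occurs : ∀ {k n} → Vector (Fin n) k → Fin n → Bool
occurs {zero}  E d = false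
occurs {suc k} E d = finEq d (E zero) ∨ occurs (E ∘ suc) d

occurs-false : ∀ {k n} (E : Vector (Fin n) k) d → occurs E d ≡ false → ∀ i → finEq d (E i) ≡ false
occurs-false {suc k} E d fresh i with finEq d (E zero) in d≢E₀
occurs-false {suc k} E d ()    i       | true
occurs-false {suc k} E d fresh zero    | false = d≢E₀
occurs-false {suc k} E d fresh (suc i) | false = occurs-false (E ∘ suc) d fresh i

-- Inclusion–exclusion for adjoining the point e to h, written without subtraction.
card-insert : ∀ n (e : Fin n) (h g : Fin n → Bool) →
  when (h e ∧ g e) 1 + card n ((λ d → finEq d e ∨ h d) ∩ g) ≡ when (g e) 1 + card n (h ∩ g)
card-insert (suc n) zero    h g = x∙yz≈y∙xz (when (h zero ∧ g zero) 1) (when (g zero) 1) _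
card-insert (suc n) (suc e) h g = begin
  a + (b + card n F)  ≡⟨ x∙yz≈y∙xz a b (card n F) ⟩
  b + (a + card n F)  ≡⟨ cong (b +_) (card-insert n e (h ∘ suc) (g ∘ suc)) ⟩
  b + (c + Y)         ≡⟨ x∙yz≈y∙xz b c Y ⟩
  c + (b + Y)         ∎
  where
  open ≡-Reasoning
  a = when (h (suc e) ∧ g (suc e)) 1
  b = when (h zero ∧ g zero) 1
  c = when (g (suc e)) 1
  F = (λ d → finEq d e ∨ h (suc d)) ∩ (g ∘ suc)
  Y = card n ((h ∘ suc) ∩ (g ∘ suc))

card-occurs-≤ : ∀ {k} n (E : Vector (Fin n) k) (g : Fin n → Bool) → card n (occurs E ∩ g) ≤ k
card-occurs-≤ {zero}  n E g = ≤-reflexive (card-const n false)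
card-occurs-≤ {suc k} n E g = begin
  card n (occurs E ∩ g)                                   ≤⟨ m≤n+m _ _ ⟩
  when (occurs (E ∘ suc) (E zero) ∧ g (E zero)) 1 + card n (occurs E ∩ g)
    ≡⟨ card-insert n (E zero) (occurs (E ∘ suc)) g ⟩
  when (g (E zero)) 1 + card n (occurs (E ∘ suc) ∩ g)
    ≤⟨ +-mono-≤ (when-≤ _ 1) (card-occurs-≤ n (E ∘ suc) g) ⟩
  suc k                                                   ∎
  where open ≤-Reasoning

SameEqualities : ∀ {k n₁ n₂} → Vector (Fin n₁) k → Vector (Fin n₂) k → Set
SameEqualities E₁ E₂ = ∀ i j → finEq (E₁ i) (E₁ j) ≡ finEq (E₂ i) (E₂ j)

occurs-cong : ∀ {k n₁ n₂} (E₁ : Vector (Fin n₁) k) (E₂ : Vector (Fin n₂) k) {d₁ d₂} →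
  (∀ i → finEq d₁ (E₁ i) ≡ finEq d₂ (E₂ i)) → occurs E₁ d₁ ≡ occurs E₂ d₂
occurs-cong {zero}  E₁ E₂ eqs = refl
occurs-cong {suc k} E₁ E₂ eqs = cong₂ _∨_ (eqs zero) (occurs-cong (E₁ ∘ suc) (E₂ ∘ suc) (eqs ∘ suc))

card-occurs-∩-≡ : ∀ {k n₁ n₂} (E₁ : Vector (Fin n₁) k) (E₂ : Vector (Fin n₂) k) →
  SameEqualities E₁ E₂ → (g₁ : Fin n₁ → Bool) (g₂ : Fin n₂ → Bool) → (∀ i → g₁ (E₁ i) ≡ g₂ (E₂ i)) →
  card n₁ (occurs E₁ ∩ g₁) ≡ card n₂ (occurs E₂ ∩ g₂)
card-occurs-∩-≡ {zero}  {n₁} {n₂} E₁ E₂ eqs g₁ g₂ g≡ =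
  trans (card-const n₁ false) (sym (card-const n₂ false))
card-occurs-∩-≡ {suc k} {n₁} {n₂} E₁ E₂ eqs g₁ g₂ g≡ =
  +-cancelˡ-≡ (when (repeated₁ ∧ g₁ (E₁ zero)) 1) _ _ (begin
  when (repeated₁ ∧ g₁ (E₁ zero)) 1 + card n₁ (occurs E₁ ∩ g₁)
    ≡⟨ card-insert n₁ (E₁ zero) (occurs (E₁ ∘ suc)) g₁ ⟩
  when (g₁ (E₁ zero)) 1 + card n₁ (occurs (E₁ ∘ suc) ∩ g₁)
    ≡⟨ cong₂ (λ b c → when b 1 + c) (g≡ zero)
             (card-occurs-∩-≡ (E₁ ∘ suc) (E₂ ∘ suc) (λ i j → eqs (suc i) (suc j)) g₁ g₂ (g≡ ∘ suc)) ⟩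
  when (g₂ (E₂ zero)) 1 + card n₂ (occurs (E₂ ∘ suc) ∩ g₂)
    ≡⟨ card-insert n₂ (E₂ zero) (occurs (E₂ ∘ suc)) g₂ ⟨
  when (repeated₂ ∧ g₂ (E₂ zero)) 1 + card n₂ (occurs E₂ ∩ g₂)
    ≡⟨ cong (λ b → when b 1 + card n₂ (occurs E₂ ∩ g₂)) (cong₂ _∧_ repeated≡ (g≡ zero)) ⟨
  when (repeated₁ ∧ g₁ (E₁ zero)) 1 + card n₂ (occurs E₂ ∩ g₂) ∎)
  where
  open ≡-Reasoning
  repeated₁ = occurs (E₁ ∘ suc) (E₁ zero)
  repeated₂ = occurs (E₂ ∘ suc) (E₂ zero)
  repeated≡ : repeated₁ ≡ repeated₂
  repeated≡ = occurs-cong (E₁ ∘ suc) (E₂ ∘ suc) (λ i → eqs zero (suc i))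

-- Cells
Cell : Set
Cell = Bool × Bool

pattern PQ   = (true , true)
pattern P¬Q  = (true , false)
pattern ¬PQ  = (false , true)
pattern ¬P¬Q = (false , false)

holds : Sym → Cell → Bool
holds P (p , q) = p
holds Q (p , q) = q

matches : Cell → Cell → Bool
matches (p , q) (p′ , q′) = (p′ is p) ∧ (q′ is q)

inCell : ∀ {n} → Interp n → Cell → Fin n → Bool
inCell I c d = matches c (I P d , I Q d)

inCell⇒holds : ∀ {n} (I : Interp n) c d → inCell I c d ≡ true → ∀ s → I s d ≡ holds s c
inCell⇒holds I (p , q) d inc P = is⇒≡ (I P d) p (∧-conicalˡ _ _ inc)
inCell⇒holds I (p , q) d inc Q = is⇒≡ (I Q d) q (∧-conicalʳ _ _ inc)

cellSize : ∀ {n} → Interp n → Cell → ℕ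
cellSize {n} I c = card n (inCell I c)

smallSize : ∀ {n} → Interp n → ℕ
smallSize I = cellSize I PQ + (cellSize I P¬Q + cellSize I ¬PQ)

∧-shuffle : ∀ a b c d → a ∧ (b ∧ (c ∧ d)) ≡ (c ∧ (b ∧ a)) ∧ d
∧-shuffle true  true  c d = cong (_∧ d) (sym (∧-identityʳ c))
∧-shuffle true  false c d = cong (_∧ d) (sym (∧-zeroʳ c))
∧-shuffle false true  c d = cong (_∧ d) (sym (∧-zeroʳ c))
∧-shuffle false false c d = cong (_∧ d) (sym (∧-zeroʳ c))

card-cells : ∀ {n} (I : Interp n) (g f : Fin n → Bool) →
  card n (g ∩ f) ≡ (card n ((g ∩ inCell I PQ) ∩ f)
                     + (card n ((g ∩ inCell I P¬Q) ∩ f) + card n ((g ∩ inCell I ¬PQ) ∩ f)))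
                    + card n ((g ∩ inCell I ¬P¬Q) ∩ f)
card-cells {n} I g f = begin
  card n (g ∩ f)
    ≡⟨ card-split n (I P) (g ∩ f) ⟩
  card n (I P ∩ g ∩ f) + card n (∁ (I P) ∩ g ∩ f)
    ≡⟨ cong₂ _+_ (card-split n (I Q) _) (card-split n (I Q) _) ⟩
  (card n (I Q ∩ I P ∩ g ∩ f) + card n (∁ (I Q) ∩ I P ∩ g ∩ f))
    + (card n (I Q ∩ ∁ (I P) ∩ g ∩ f) + card n (∁ (I Q) ∩ ∁ (I P) ∩ g ∩ f))
    ≡⟨ cong₂ _+_ (cong₂ _+_ (cell true true) (cell true false))
                 (cong₂ _+_ (cell false true) (cell false false)) ⟩
  (a + b) + (c + e)   ≡⟨ +-assoc (a + b) c e ⟨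
  ((a + b) + c) + e   ≡⟨ cong (_+ e) (+-assoc a b c) ⟩
  (a + (b + c)) + e   ∎
  where
  open ≡-Reasoning
  cell : ∀ p q → card n ((λ d → I Q d is q) ∩ (λ d → I P d is p) ∩ g ∩ f)
               ≡ card n ((g ∩ inCell I (p , q)) ∩ f)
  cell p q = card-cong n (λ d → ∧-shuffle (I Q d is q) (I P d is p) (g d) (f d))
  a = card n ((g ∩ inCell I PQ) ∩ f)
  b = card n ((g ∩ inCell I P¬Q) ∩ f)
  c = card n ((g ∩ inCell I ¬PQ) ∩ f)
  e = card n ((g ∩ inCell I ¬P¬Q) ∩ f)

fresh : ∀ {k n} → Interp n → Vector (Fin n) k → Cell → Fin n → Bool
fresh I E c = ∁ (occurs E) ∩ inCell I c

fresh⇒ : ∀ {k n} (I : Interp n) (E : Vector (Fin n) k) c z →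
  fresh I E c z ≡ true → occurs E z ≡ false × inCell I c z ≡ true
fresh⇒ I E c z fz =
  not-injective (∧-conicalˡ (not (occurs E z)) _ fz) , ∧-conicalʳ (not (occurs E z)) _ fz

freshSize : ∀ {k n} → Interp n → Vector (Fin n) k → Cell → ℕ
freshSize {n = n} I E c = card n (fresh I E c)

part : ∀ {k n} → Interp n → Vector (Fin n) k → Cell → (Fin n → Bool) → ℕ
part {n = n} I E c f = card n (fresh I E c ∩ f)

outsideBulk : ∀ {k n} → Interp n → Vector (Fin n) k → (Fin n → Bool) → ℕ
outsideBulk {n = n} I E f = card n (occurs E ∩ f) + (part I E PQ f + (part I E P¬Q f + part I E ¬PQ f))

card≡outsideBulk+bulk : ∀ {k n} (I : Interp n) (E : Vector (Fin n) k) f →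
  card n f ≡ outsideBulk I E f + part I E ¬P¬Q f
card≡outsideBulk+bulk {n = n} I E f = begin
  card n f                                          ≡⟨ card-split n (occurs E) f ⟩
  card n (occurs E ∩ f) + card n (∁ (occurs E) ∩ f) ≡⟨ cong (card n (occurs E ∩ f) +_) (card-cells I _ f) ⟩
  card n (occurs E ∩ f) + (small + part I E ¬P¬Q f) ≡⟨ +-assoc (card n (occurs E ∩ f)) small _ ⟨
  outsideBulk I E f + part I E ¬P¬Q f               ∎
  where
  open ≡-Reasoning
  small = part I E PQ f + (part I E P¬Q f + part I E ¬PQ f)

cellSize≡occurring+fresh : ∀ {k n} (I : Interp n) (E : Vector (Fin n) k) c →
  cellSize I c ≡ card n (occurs E ∩ inCell I c) + freshSize I E c
cellSize≡occurring+fresh {n = n} I E c = card-split n (occurs E) (inCell I c)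

part≤cellSize : ∀ {k n} (I : Interp n) (E : Vector (Fin n) k) c f → part I E c f ≤ cellSize I c
part≤cellSize {n = n} I E c f = begin
  part I E c f                                    ≤⟨ card-∩-≤ n (fresh I E c) f ⟩
  freshSize I E c                                 ≤⟨ m≤n+m _ _ ⟩
  card n (occurs E ∩ inCell I c) + freshSize I E c ≡⟨ cellSize≡occurring+fresh I E c ⟨
  cellSize I c                                    ∎
  where open ≤-Reasoning

outsideBulk≤ : ∀ {k n} (I : Interp n) (E : Vector (Fin n) k) f → outsideBulk I E f ≤ k + smallSize I
outsideBulk≤ {n = n} I E f =
  +-mono-≤ (card-occurs-≤ n E f)
           (+-mono-≤ (part≤cellSize I E PQ f)
                     (+-mono-≤ (part≤cellSize I E P¬Q f) (part≤cellSize I E ¬PQ f)))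

cellSize≤pebbles+fresh : ∀ {k n} (I : Interp n) (E : Vector (Fin n) k) c →
  cellSize I c ≤ k + freshSize I E c
cellSize≤pebbles+fresh {n = n} I E c =
  ≤-trans (≤-reflexive (cellSize≡occurring+fresh I E c)) (+-monoˡ-≤ _ (card-occurs-≤ n E (inCell I c)))

fresh-bulk-exceeds : ∀ {k n} (I : Interp n) (E : Vector (Fin n) k) {M R S} → k ≤ M → R ≤ k + S →
  M + (M + S) < cellSize I ¬P¬Q → R < freshSize I E ¬P¬Q
fresh-bulk-exceeds {k} I E {M} {R} {S} k≤M R≤k+S large = +-cancelˡ-< k R _ (begin-strict
  k + R                  ≤⟨ +-mono-≤ k≤M (≤-trans R≤k+S (+-monoˡ-≤ S k≤M)) ⟩
  M + (M + S)            <⟨ large ⟩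
  cellSize I ¬P¬Q        ≤⟨ cellSize≤pebbles+fresh I E ¬P¬Q ⟩
  k + freshSize I E ¬P¬Q ∎)
  where open ≤-Reasoning

-- Counts with one large block
record SameShape (N₁ N₂ c₁ c₂ : ℕ) : Set where
  field
    rest    : ℕ
    filled  : Bool
    rest<N₁ : rest < N₁
    rest<N₂ : rest < N₂
    c₁≡     : c₁ ≡ rest + when filled N₁
    c₂≡     : c₂ ≡ rest + when filled N₂

BlockOrder : Bool → Bool → ℕ → ℕ → Set
BlockOrder true  false r s = ⊥
BlockOrder false true  r s = ⊤
BlockOrder _     _     r s = r ≤ s

≤-blocks : ∀ {N r s} v w → r < N → s < N → (r + when v N ≤ s + when w N) ⇔ BlockOrder v w r s
≤-blocks {N} {r} {s} true  true  r<N s<N = mk⇔ (+-cancelʳ-≤ N r s) (+-monoˡ-≤ N)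
≤-blocks {N} {r} {s} false false r<N s<N =
  mk⇔ (subst₂ _≤_ (+-identityʳ r) (+-identityʳ s)) (+-monoˡ-≤ 0)
≤-blocks {N} {r} {s} true  false r<N s<N =
  mk⇔ (λ r+N≤s → <⇒≱ s<N (≤-trans (m≤n+m N r) (subst (r + N ≤_) (+-identityʳ s) r+N≤s))) ⊥-elim
≤-blocks {N} {r} {s} false true  r<N s<N =
  mk⇔ (const tt) (const (subst (_≤ s + N) (sym (+-identityʳ r)) (≤-trans (<⇒≤ r<N) (m≤n+m N s))))

SameShape-≤ᵇ : ∀ {N₁ N₂ a₁ a₂ b₁ b₂} → SameShape N₁ N₂ a₁ a₂ → SameShape N₁ N₂ b₁ b₂ →
  (a₁ ≤ᵇ b₁) ≡ (a₂ ≤ᵇ b₂)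
SameShape-≤ᵇ a b
  rewrite SameShape.c₁≡ a | SameShape.c₂≡ a | SameShape.c₁≡ b | SameShape.c₂≡ b = ≤ᵇ-cong (⇔.trans
  (≤-blocks (filled a) (filled b) (rest<N₁ a) (rest<N₁ b))
  (⇔.sym (≤-blocks (filled a) (filled b) (rest<N₂ a) (rest<N₂ b))))
  where open SameShape

SameShape-empty : ∀ {N₁ N₂ c₁ c₂} → SameShape N₁ N₂ c₁ c₂ → SameShape N₁ N₂ 0 0
SameShape-empty sh = record
  { rest = 0 ; filled = false
  ; rest<N₁ = ≤-<-trans z≤n (rest<N₁ sh) ; rest<N₂ = ≤-<-trans z≤n (rest<N₂ sh)
  ; c₁≡ = refl ; c₂≡ = refl }
  where open SameShape

-- Partial isomorphisms
Pebbled : ∀ {k n₁ n₂} → Vector (Fin n₁) k → Vector (Fin n₂) k → (Var → Fin n₁) → (Var → Fin n₂) → Set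
Pebbled E₁ E₂ ρ₁ ρ₂ = ∀ x → ∃[ i ] ρ₁ x ≡ E₁ i × ρ₂ x ≡ E₂ i

Pebbled-update : ∀ {k n₁ n₂} {E₁ : Vector (Fin n₁) k} {E₂ : Vector (Fin n₂) k} {ρ₁ ρ₂} →
  Pebbled E₁ E₂ ρ₁ ρ₂ → ∀ x d₁ d₂ → Pebbled (d₁ ∷ E₁) (d₂ ∷ E₂) (ρ₁ [ x ↦ d₁ ]) (ρ₂ [ x ↦ d₂ ])
Pebbled-update peb x d₁ d₂ y with y ≡ᵇ x
... | true  = zero , refl , refl
... | false = let i , ρ₁y , ρ₂y = peb y in suc i , ρ₁y , ρ₂y

rank : Formula → ℕ
rank (atom _ _)    = 0
rank (_ ≐ _)       = 0
rank ⊤f            = 0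
rank (¬f φ)        = rank φ
rank (φ ∧f ψ)      = rank φ ⊔ rank ψ
rank (φ ∨f ψ)      = rank φ ⊔ rank ψ
rank (∃f _ φ)      = suc (rank φ)
rank (∀f _ φ)      = suc (rank φ)
rank (cnt _ φ _ ψ) = suc (rank φ ⊔ rank ψ)

module Comparison {n₁ n₂} (I₁ : Interp n₁) (I₂ : Interp n₂) where

  record PartialIso {k} (E₁ : Vector (Fin n₁) k) (E₂ : Vector (Fin n₂) k) : Set where
    field
      sameEqualities : SameEqualities E₁ E₂
      samePredicates : ∀ s i → I₁ s (E₁ i) ≡ I₂ s (E₂ i)
  open PartialIso public

  extend : ∀ {k} {E₁ : Vector (Fin n₁) k} {E₂ : Vector (Fin n₂) k} {z₁ z₂} → PartialIso E₁ E₂ →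
    (∀ i → finEq z₁ (E₁ i) ≡ finEq z₂ (E₂ i)) → (∀ s → I₁ s z₁ ≡ I₂ s z₂) → PartialIso (z₁ ∷ E₁) (z₂ ∷ E₂)
  sameEqualities (extend {z₁ = z₁} {z₂} iso z≡ s≡) zero zero = trans (finEq-refl z₁) (sym (finEq-refl z₂))
  sameEqualities (extend iso z≡ s≡) zero (suc j) = z≡ j
  sameEqualities (extend {E₁ = E₁} {E₂} {z₁} {z₂} iso z≡ s≡) (suc i) zero =
    trans (finEq-sym (E₁ i) z₁) (trans (z≡ i) (finEq-sym z₂ (E₂ i)))
  sameEqualities (extend iso z≡ s≡) (suc i) (suc j) = sameEqualities iso i j
  samePredicates (extend iso z≡ s≡) s zero    = s≡ s
  samePredicates (extend iso z≡ s≡) s (suc i) = samePredicates iso s i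

  Invariant : ∀ {k} → Vector (Fin n₁) k → Vector (Fin n₂) k → (Fin n₁ → Bool) → (Fin n₂ → Bool) → Set
  Invariant E₁ E₂ f₁ f₂ = ∀ {z₁ z₂} → PartialIso (z₁ ∷ E₁) (z₂ ∷ E₂) → f₁ z₁ ≡ f₂ z₂

  module _ {k} {E₁ : Vector (Fin n₁) k} {E₂ : Vector (Fin n₂) k} (iso : PartialIso E₁ E₂) where

    extend-pebble : ∀ i → PartialIso (E₁ i ∷ E₁) (E₂ i ∷ E₂)
    extend-pebble i = extend iso (sameEqualities iso i) (λ s → samePredicates iso s i)

    extend-fresh : ∀ {c z₁ z₂} → fresh I₁ E₁ c z₁ ≡ true → fresh I₂ E₂ c z₂ ≡ true →
      PartialIso (z₁ ∷ E₁) (z₂ ∷ E₂)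
    extend-fresh {c} {z₁} {z₂} fresh₁ fresh₂ =
      extend iso (λ i → trans (occurs-false E₁ z₁ new₁ i) (sym (occurs-false E₂ z₂ new₂ i)))
                 (λ s → trans (inCell⇒holds I₁ c z₁ cell₁ s) (sym (inCell⇒holds I₂ c z₂ cell₂ s)))
      where
      new₁ = proj₁ (fresh⇒ I₁ E₁ c z₁ fresh₁)
      new₂ = proj₁ (fresh⇒ I₂ E₂ c z₂ fresh₂)
      cell₁ = proj₂ (fresh⇒ I₁ E₁ c z₁ fresh₁)
      cell₂ = proj₂ (fresh⇒ I₂ E₂ c z₂ fresh₂)

    inCell-pebbles : ∀ c i → inCell I₁ c (E₁ i) ≡ inCell I₂ c (E₂ i)
    inCell-pebbles (p , q) i =
      cong₂ (λ x y → (x is p) ∧ (y is q)) (samePredicates iso P i) (samePredicates iso Q i)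

    freshSize-≡ : ∀ c → cellSize I₁ c ≡ cellSize I₂ c → freshSize I₁ E₁ c ≡ freshSize I₂ E₂ c
    freshSize-≡ c size≡ = +-cancelˡ-≡ (card n₁ (occurs E₁ ∩ inCell I₁ c)) _ _ (begin
      card n₁ (occurs E₁ ∩ inCell I₁ c) + freshSize I₁ E₁ c ≡⟨ cellSize≡occurring+fresh I₁ E₁ c ⟨
      cellSize I₁ c                                         ≡⟨ size≡ ⟩
      cellSize I₂ c                                         ≡⟨ cellSize≡occurring+fresh I₂ E₂ c ⟩
      card n₂ (occurs E₂ ∩ inCell I₂ c) + freshSize I₂ E₂ c ≡⟨ cong (_+ freshSize I₂ E₂ c) occurring≡ ⟨
      card n₁ (occurs E₁ ∩ inCell I₁ c) + freshSize I₂ E₂ c ∎)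
      where
      open ≡-Reasoning
      occurring≡ = card-occurs-∩-≡ E₁ E₂ (sameEqualities iso) (inCell I₁ c) (inCell I₂ c) (inCell-pebbles c)

    module _ {f₁ f₂} (inv : Invariant E₁ E₂ f₁ f₂) where

      part-uniform : ∀ c → 0 < freshSize I₁ E₁ c → 0 < freshSize I₂ E₂ c →
        ∃[ v ] part I₁ E₁ c f₁ ≡ when v (freshSize I₁ E₁ c) × part I₂ E₂ c f₂ ≡ when v (freshSize I₂ E₂ c)
      part-uniform c pos₁ pos₂ =
        let z₁ , fresh-z₁ = card-witness n₁ (fresh I₁ E₁ c) pos₁
            z₂ , fresh-z₂ = card-witness n₂ (fresh I₂ E₂ c) pos₂
        in f₂ z₂
         , card-∩-constant n₁ _ f₁ (f₂ z₂) (λ d fresh-d → inv (extend-fresh {c} fresh-d fresh-z₂))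
         , card-∩-constant n₂ _ f₂ (f₂ z₂) (λ d fresh-d →
             trans (sym (inv (extend-fresh {c} fresh-z₁ fresh-d))) (inv (extend-fresh {c} fresh-z₁ fresh-z₂)))

      part-≡ : ∀ c → freshSize I₁ E₁ c ≡ freshSize I₂ E₂ c → part I₁ E₁ c f₁ ≡ part I₂ E₂ c f₂
      part-≡ c size≡ with freshSize I₁ E₁ c in size₁
      ... | zero  = trans (card-∩-empty n₁ _ f₁ size₁) (sym (card-∩-empty n₂ _ f₂ (sym size≡)))
      ... | suc _ =
        let v , part₁≡ , part₂≡ =
              part-uniform c (subst (0 <_) (sym size₁) (s≤s z≤n)) (subst (0 <_) size≡ (s≤s z≤n))
        in trans part₁≡ (trans (cong (when v) (trans size₁ size≡)) (sym part₂≡))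

      outsideBulk-≡ : (∀ c → c ≢ ¬P¬Q → cellSize I₁ c ≡ cellSize I₂ c) →
        outsideBulk I₁ E₁ f₁ ≡ outsideBulk I₂ E₂ f₂
      outsideBulk-≡ small≡ =
        cong₂ _+_ (card-occurs-∩-≡ E₁ E₂ (sameEqualities iso) f₁ f₂ (inv ∘ extend-pebble))
                  (cong₂ _+_ (small PQ (λ ())) (cong₂ _+_ (small P¬Q (λ ())) (small ¬PQ (λ ()))))
        where
        small : ∀ c → c ≢ ¬P¬Q → part I₁ E₁ c f₁ ≡ part I₂ E₂ c f₂
        small c c≢ = part-≡ c (freshSize-≡ c (small≡ c c≢))

  module Simulation (M : ℕ) (small≡ : ∀ c → c ≢ ¬P¬Q → cellSize I₁ c ≡ cellSize I₂ c)
                   (bulk₁ : M + (M + smallSize I₁) < cellSize I₁ ¬P¬Q)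
                   (bulk₂ : M + (M + smallSize I₁) < cellSize I₂ ¬P¬Q) where

    module _ {k} {E₁ : Vector (Fin n₁) k} {E₂ : Vector (Fin n₂) k}
             (iso : PartialIso E₁ E₂) (k≤M : k ≤ M) where

      shape : ∀ {f₁ f₂} → Invariant E₁ E₂ f₁ f₂ →
        SameShape (freshSize I₁ E₁ ¬P¬Q) (freshSize I₂ E₂ ¬P¬Q) (count n₁ f₁) (count n₂ f₂)
      shape {f₁} {f₂} inv = record
        { rest = R ; filled = v ; rest<N₁ = R<N₁ ; rest<N₂ = R<N₂
        ; c₁≡ = trans (count≡card n₁ f₁) (trans (card≡outsideBulk+bulk I₁ E₁ f₁) (cong (R +_) bulk₁≡))
        ; c₂≡ = trans (count≡card n₂ f₂) (trans (card≡outsideBulk+bulk I₂ E₂ f₂)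
                  (cong₂ _+_ (sym (outsideBulk-≡ iso inv small≡)) bulk₂≡)) }
        where
        R = outsideBulk I₁ E₁ f₁
        R<N₁ = fresh-bulk-exceeds I₁ E₁ k≤M (outsideBulk≤ I₁ E₁ f₁) bulk₁
        R<N₂ = fresh-bulk-exceeds I₂ E₂ k≤M (outsideBulk≤ I₁ E₁ f₁) bulk₂
        uniform = part-uniform iso inv ¬P¬Q (≤-<-trans z≤n R<N₁) (≤-<-trans z≤n R<N₂)
        v = proj₁ uniform
        bulk₁≡ = proj₁ (proj₂ uniform)
        bulk₂≡ = proj₂ (proj₂ uniform)

      anyFin-agrees : ∀ {f₁ f₂} → Invariant E₁ E₂ f₁ f₂ → anyFin n₁ f₁ ≡ anyFin n₂ f₂
      anyFin-agrees {f₁} {f₂} inv = begin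
        anyFin n₁ f₁             ≡⟨ anyFin≡count≰0 n₁ f₁ ⟩
        not (count n₁ f₁ ≤ᵇ 0)   ≡⟨ cong not (SameShape-≤ᵇ sh (SameShape-empty sh)) ⟩
        not (count n₂ f₂ ≤ᵇ 0)   ≡⟨ anyFin≡count≰0 n₂ f₂ ⟨
        anyFin n₂ f₂             ∎
        where
        open ≡-Reasoning
        sh = shape inv

    preserves : ∀ φ {k r} {E₁ : Vector (Fin n₁) k} {E₂ : Vector (Fin n₂) k} {ρ₁ ρ₂} →
      PartialIso E₁ E₂ → Pebbled E₁ E₂ ρ₁ ρ₂ → rank φ ≤ r → k + r ≤ M → eval I₁ φ ρ₁ ≡ eval I₂ φ ρ₂

    preserves-binding : ∀ φ x {k r} {E₁ : Vector (Fin n₁) k} {E₂ : Vector (Fin n₂) k} {ρ₁ ρ₂} →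
      Pebbled E₁ E₂ ρ₁ ρ₂ → rank φ ≤ r → k + suc r ≤ M →
      Invariant E₁ E₂ (λ d → eval I₁ φ (ρ₁ [ x ↦ d ])) (λ d → eval I₂ φ (ρ₂ [ x ↦ d ]))

    preserves (atom s x) iso peb _ _ with peb x
    ... | i , ρ₁x , ρ₂x rewrite ρ₁x | ρ₂x = samePredicates iso s i
    preserves (x ≐ y) iso peb _ _ with peb x | peb y
    ... | i , ρ₁x , ρ₂x | j , ρ₁y , ρ₂y rewrite ρ₁x | ρ₂x | ρ₁y | ρ₂y = sameEqualities iso i j
    preserves ⊤f iso peb _ _ = refl
    preserves (¬f φ) iso peb r≤ k+r≤M = cong not (preserves φ iso peb r≤ k+r≤M)
    preserves (φ ∧f ψ) iso peb r≤ k+r≤M =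
      cong₂ _∧_ (preserves φ iso peb (m⊔n≤o⇒m≤o _ _ r≤) k+r≤M)
                (preserves ψ iso peb (m⊔n≤o⇒n≤o _ _ r≤) k+r≤M)
    preserves (φ ∨f ψ) iso peb r≤ k+r≤M =
      cong₂ _∨_ (preserves φ iso peb (m⊔n≤o⇒m≤o _ _ r≤) k+r≤M)
                (preserves ψ iso peb (m⊔n≤o⇒n≤o _ _ r≤) k+r≤M)
    preserves (∃f x φ) {k} iso peb (s≤s r≤) k+r≤M =
      anyFin-agrees iso (m+n≤o⇒m≤o k k+r≤M) (preserves-binding φ x peb r≤ k+r≤M)
    preserves (∀f x φ) {k} iso peb (s≤s r≤) k+r≤M =
      cong not (anyFin-agrees iso (m+n≤o⇒m≤o k k+r≤M) (cong not ∘ preserves-binding φ x peb r≤ k+r≤M))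
    preserves (cnt x φ y ψ) {k} iso peb (s≤s r≤) k+r≤M =
      SameShape-≤ᵇ (shape iso (m+n≤o⇒m≤o k k+r≤M) (preserves-binding ψ y peb (m⊔n≤o⇒n≤o _ _ r≤) k+r≤M))
                   (shape iso (m+n≤o⇒m≤o k k+r≤M) (preserves-binding φ x peb (m⊔n≤o⇒m≤o _ _ r≤) k+r≤M))

    preserves-binding φ x {k} {r} peb r≤ k+r≤M iso′ =
      preserves φ iso′ (Pebbled-update peb x _ _) r≤ (subst (_≤ M) (+-suc k r) k+r≤M)

-- The two models
block : ∀ {n} → Cell → (m : ℕ) → Vector Cell n → Vector Cell (m + n)
block c zero    v = v
block c (suc m) v = c ∷ block c m v

card-block : ∀ {n} (g : Cell → Bool) c m (v : Vector Cell n) →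
  card (m + n) (g ∘ block c m v) ≡ card m (const (g c)) + card n (g ∘ v)
card-block g c zero    v = refl
card-block g c (suc m) v =
  trans (cong (when (g c) 1 +_) (card-block g c m v)) (sym (+-assoc (when (g c) 1) _ _))

layout : (a b c d : ℕ) → Vector Cell (suc (a + (b + (c + d))))
layout a b c d = block PQ (suc a) (block P¬Q b (block ¬PQ c (replicate d ¬P¬Q)))

model : (a b c d : ℕ) → Interp (suc (a + (b + (c + d))))
model a b c d s i = holds s (layout a b c d i)

card-layout : ∀ a b c d (g : Cell → Bool) → card _ (g ∘ layout a b c d)
  ≡ when (g PQ) (suc a) + (when (g P¬Q) b + (when (g ¬PQ) c + when (g ¬P¬Q) d))
card-layout a b c d g =
  trans (card-block g PQ (suc a) _) (cong₂ _+_ (card-const (suc a) (g PQ))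
  (trans (card-block g P¬Q b _) (cong₂ _+_ (card-const b (g P¬Q))
  (trans (card-block g ¬PQ c _) (cong₂ _+_ (card-const c (g ¬PQ)) (card-const d (g ¬P¬Q)))))))

count-layout : ∀ a b c d (g : Cell → Bool) → count _ (g ∘ layout a b c d)
  ≡ when (g PQ) (suc a) + (when (g P¬Q) b + (when (g ¬PQ) c + when (g ¬P¬Q) d))
count-layout a b c d g = trans (count≡card _ (g ∘ layout a b c d)) (card-layout a b c d g)

#Q-model≢0 : ∀ a b c d → #Q (model a b c d) ≢ 0
#Q-model≢0 a b c d #Q≡0 with trans (sym (count-layout a b c d (holds Q))) #Q≡0
... | ()

many-model : ∀ a b c d → ManyQP (model a b c d) ⇔ b * c < suc a * d
many-model a b c d = mk⇔
  (λ many → +-cancelˡ-< X _ _ (subst₂ _<_ PQ≡ n·PQ≡ many))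
  (λ bc<ad → subst₂ _<_ (sym PQ≡) (sym n·PQ≡) (+-monoʳ-< X bc<ad))
  where
  I = model a b c d
  X = suc a * suc (a + (b + c))
  PQ≡ : #P I * #Q I ≡ X + b * c
  PQ≡ = trans (cong₂ _*_ (count-layout a b c d (holds P)) (count-layout a b c d (holds Q))) (product a b c)
    where
    product : ∀ a b c → (suc a + (b + 0)) * (suc a + (c + 0)) ≡ suc a * suc (a + (b + c)) + b * c
    product = solve-∀
  n·PQ≡ : #PQ I * suc (a + (b + (c + d))) ≡ X + suc a * d
  n·PQ≡ = trans (cong (_* suc (a + (b + (c + d)))) (count-layout a b c d (λ x → holds P x ∧ holds Q x)))
                (product a b c d)
    where
    product : ∀ a b c d → (suc a + 0) * suc (a + (b + (c + d))) ≡ suc a * suc (a + (b + c)) + suc a * d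
    product = solve-∀

cellSize-model-small : ∀ a b c d d′ cell → cell ≢ ¬P¬Q →
  cellSize (model a b c d) cell ≡ cellSize (model a b c d′) cell
cellSize-model-small a b c d d′ PQ _ =
  trans (card-layout a b c d (matches PQ)) (sym (card-layout a b c d′ (matches PQ)))
cellSize-model-small a b c d d′ P¬Q _ =
  trans (card-layout a b c d (matches P¬Q)) (sym (card-layout a b c d′ (matches P¬Q)))
cellSize-model-small a b c d d′ ¬PQ _ =
  trans (card-layout a b c d (matches ¬PQ)) (sym (card-layout a b c d′ (matches ¬PQ)))
cellSize-model-small a b c d d′ ¬P¬Q ≢ = ⊥-elim (≢ refl)

smallSize-model : ∀ a b c d → smallSize (model a b c d) ≡ suc a + (b + c)
smallSize-model a b c d = trans
  (cong₂ _+_ (card-layout a b c d (matches PQ))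
             (cong₂ _+_ (card-layout a b c d (matches P¬Q)) (card-layout a b c d (matches ¬PQ))))
  (sum≡ a b c)
  where
  sum≡ : ∀ a b c → (suc a + 0) + ((b + 0) + (c + 0)) ≡ suc a + (b + c)
  sum≡ = solve-∀

bulkSize-model : ∀ a b c d → cellSize (model a b c d) ¬P¬Q ≡ d
bulkSize-model a b c d = card-layout a b c d (matches ¬P¬Q)

square-exceeds : ∀ M → M + (M + suc ((3 + M) + (3 + M))) < (3 + M) * (3 + M)
square-exceeds M = subst (M + (M + suc ((3 + M) + (3 + M))) <_) (identity M) (m≤m+n _ (suc M * suc M))
  where
  identity : ∀ M → suc (M + (M + suc ((3 + M) + (3 + M)))) + suc M * suc M ≡ (3 + M) * (3 + M)
  identity = solve-∀

bulk-dominates : ∀ M D D′ → (3 + M) * (3 + M) ≤ D →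
  M + (M + smallSize (model 0 (3 + M) (3 + M) D′)) < cellSize (model 0 (3 + M) (3 + M) D) ¬P¬Q
bulk-dominates M D D′ t²≤D = subst₂ (λ S N → M + (M + S) < N)
  (sym (smallSize-model 0 (3 + M) (3 + M) D′)) (sym (bulkSize-model 0 (3 + M) (3 + M) D))
  (<-≤-trans (square-exceeds M) t²≤D)

fact3p7 : ¬ (Σ Formula λ φ → Sentence φ ×
            ((n : ℕ) (I : Interp (suc n)) → #Q I ≢ 0 →
               ((I ⊨ φ → ManyQP I) × (ManyQP I → I ⊨ φ))))
fact3p7 (φ , _ , defines) =
  <-irrefl refl (subst (t * t <_) (*-identityˡ (t * t)) (Equivalence.to (many-model 0 t t (t * t)) many₂))
  where
  M = suc (rank φ)
  t = 3 + M
  I₁ = model 0 t t (suc (t * t))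
  I₂ = model 0 t t (t * t)
  open Comparison I₁ I₂
  open Simulation M (cellSize-model-small 0 t t _ _)
                    (bulk-dominates M _ _ (n≤1+n _)) (bulk-dominates M _ _ ≤-refl)
  -- φ need not be closed: ⊨ evaluates under a constant assignment, whose two values match.
  roots : PartialIso {1} (λ _ → zero) (λ _ → zero)
  roots = record { sameEqualities = λ _ _ → refl ; samePredicates = λ { P _ → refl ; Q _ → refl } }
  agree : eval I₁ φ (λ _ → zero) ≡ eval I₂ φ (λ _ → zero)
  agree = preserves φ roots (λ _ → zero , refl , refl) ≤-refl ≤-refl
  many₁ : ManyQP I₁
  many₁ = Equivalence.from (many-model 0 t t (suc (t * t))) (subst (t * t <_) (sym (*-identityˡ _)) ≤-refl)
  many₂ : ManyQP I₂
  many₂ = proj₁ (defines _ I₂ (#Q-model≢0 0 t t _))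
                (trans (sym agree) (proj₂ (defines _ I₁ (#Q-model≢0 0 t t _)) many₁))
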